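{- Let $k\ge 2$, let $G$ be a finite simple $k$-chromatic graph, and let $\{u,v\}$ be a pair of distinct vertices of $G$ which is an implicit-edge (respectively, an implicit-identity) of $G$. Let $S$ be a critical independent set of $G$ with $u,v\notin S$, so that $H=G-S$ is $(k-1)$-chromatic and $u,v\in V(H)$. Then $\{u,v\}$ is an implicit-edge (respectively, an implicit-identity) of $H$.
   Context: All graphs are finite and simple. For a positive integer $k$, a $k$-coloring of a graph $G$ is a proper vertex coloring $c:V(G)\to\{1,\dots,k\}$; $\chi(G)$ is the chromatic number and $G$ is $k$-chromatic if $\chi(G)=k$. For distinct vertices $u,v$, $G-uv$ denotes $G$ with the edge $uv$ deleted if present (and $G$ otherwise). For a $k$-chromatic graph $G$ and distinct $u,v\in V(G)$: $\{u,v\}$ is an implicit-edge of $G$ if no $k$-coloring $c$ of $G-uv$ has $c(u)=c(v)$, and an implicit-identity of $G$ if no $k$-coloring $c$ of $G-uv$ has $c(u)\neq c(v)$ (here $k=\chi(G)$; for $H$ these notions are taken with $k-1=\chi(H)$). An independent set $S$ of a $k$-chromatic graph $G$ is critical if $\chi(G-S)=k-1$. -}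

module Defs where

open import Data.Nat using (ℕ; suc; _≤_; _<_; _∸_)
open import Data.Fin using (Fin)
open import Data.Product using (Σ; _×_; _,_; ∃)
open import Data.Unit using (⊤)
open import Relation.Nullary using (¬_)
open import Relation.Binary.PropositionalEquality using (_≡_; _≢_)

record Graph (n : ℕ) : Set₁ where
  field
    Adj   : Fin n → Fin n → Set
    sym   : ∀ {x y} → Adj x y → Adj y x
    irrefl : ∀ {x} → ¬ Adj x x
open Graph public

VSet : ℕ → Set₁
VSet n = Fin n → Set

-- The induced subgraph on the vertex set W is represented by the pair (G , W).
-- G - S corresponds to W = complement of S; G itself to W = everything.
All : ∀ {n} → VSet n
All _ = ⊤

Compl : ∀ {n} → VSet n → VSet n
Compl S x = ¬ S x

AdjMinus : ∀ {n} → Graph n → Fin n → Fin n → Fin n → Fin n → Set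
AdjMinus G u v x y = Adj G x y × ¬ ((x ≡ u × y ≡ v) Data.Sum.⊎ (x ≡ v × y ≡ u))
  where import Data.Sum

-- A proper k-coloring of the induced subgraph of the "graph" with adjacency A on vertex set W.
-- Colors are Fin k; colors are only meaningful on vertices in W.
IsColoring : ∀ {n} → (Fin n → Fin n → Set) → VSet n → (k : ℕ) → (Fin n → Fin k) → Set
IsColoring A W k c = ∀ x y → W x → W y → A x y → c x ≢ c y

Colorable : ∀ {n} → (Fin n → Fin n → Set) → VSet n → ℕ → Set
Colorable A W k = Σ (_ → Fin k) (IsColoring A W k)

Chromatic : ∀ {n} → Graph n → VSet n → ℕ → Set
Chromatic G W k = Colorable (Adj G) W k × (∀ j → j < k → ¬ Colorable (Adj G) W j)

-- {u,v} implicit-edge of G[W] (with k = χ(G[W])): no k-coloring of G[W] - uv has c(u) = c(v).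
ImplicitEdge : ∀ {n} → Graph n → VSet n → ℕ → Fin n → Fin n → Set
ImplicitEdge G W k u v =
  ∀ (c : Fin _ → Fin k) → IsColoring (AdjMinus G u v) W k c → ¬ (c u ≡ c v)

ImplicitIdentity : ∀ {n} → Graph n → VSet n → ℕ → Fin n → Fin n → Set
ImplicitIdentity G W k u v =
  ∀ (c : Fin _ → Fin k) → IsColoring (AdjMinus G u v) W k c → ¬ (c u ≢ c v)

Independent : ∀ {n} → Graph n → VSet n → Set
Independent G S = ∀ x y → S x → S y → ¬ Adj G x y

CriticalIndependent : ∀ {n} → Graph n → ℕ → VSet n → Set
CriticalIndependent G k S = Independent G S × Chromatic G (Compl S) (k ∸ 1)

module Submission where

-- Let c be a (k-1)-colouring of (G - S) - uv.  Since S is independent in G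
-- (hence in G - uv), giving every vertex of S one fresh colour k extends c to a
-- k-colouring c⁺ of G - uv, and c⁺ agrees with c (up to the inclusion of colours
-- Fin (k-1) ↪ Fin k) on u and v, which lie outside S.  So c(u) = c(v) iff
-- c⁺(u) = c⁺(v): a colouring of H - uv violating the implicit-edge (resp.
-- implicit-identity) property of {u,v} in H yields one violating it in G.
--
-- Constructively the extension needs membership in S to be decidable.  Both
-- conclusions are negations, so it suffices that decidability of a predicate on
-- the finite vertex set Fin n holds up to double negation.

open import Defs hiding (sym)
open import Data.Nat using (ℕ; suc; _≤_; _∸_; s≤s)
open import Data.Fin using (Fin; fromℕ; inject₁)
open import Data.Fin.Properties using (fromℕ≢inject₁; inject₁-injective; sequence)
open import Data.Product using (_×_; _,_)
open import Effect.Monad using (RawMonad)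
open import Relation.Nullary using (¬_; Dec; yes; no)
open import Relation.Nullary.Decidable using (¬¬-excluded-middle)
open import Relation.Nullary.Negation using (¬¬-Monad; contradiction)
open import Relation.Binary.PropositionalEquality
  using (_≡_; _≢_; refl; sym; cong; module ≡-Reasoning)

¬¬-decidable : ∀ {n} (P : VSet n) → ¬ ¬ (∀ x → Dec (P x))
¬¬-decidable P =
  sequence (RawMonad.rawApplicative ¬¬-Monad) (λ _ → ¬¬-excluded-middle)

module FreshColour {n} (A : Fin n → Fin n → Set) (S : VSet n)
  (S-indep : ∀ x y → S x → S y → ¬ A x y) (S? : ∀ x → Dec (S x)) where

  extend : ∀ {m} → (Fin n → Fin m) → Fin n → Fin (suc m)
  extend {m} c x with S? x
  ... | yes _ = fromℕ m
  ... | no  _ = inject₁ (c x)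

  extend-outside : ∀ {m} (c : Fin n → Fin m) x → ¬ S x → extend c x ≡ inject₁ (c x)
  extend-outside c x x∉S with S? x
  ... | yes x∈S = contradiction x∈S x∉S
  ... | no  _   = refl

  extend-proper : ∀ {m} (c : Fin n → Fin m) → IsColoring A (Compl S) m c →
                  IsColoring A All (suc m) (extend c)
  extend-proper c c-proper x y _ _ xy with S? x | S? y
  ... | yes x∈S | yes y∈S = λ _ → S-indep x y x∈S y∈S xy
  ... | yes _   | no  _   = fromℕ≢inject₁
  ... | no  _   | yes _   = λ eq → fromℕ≢inject₁ (sym eq)
  ... | no  x∉S | no  y∉S = λ eq → c-proper x y x∉S y∉S xy (inject₁-injective eq)

  extend-same⇒same : ∀ {m} (c : Fin n → Fin m) {u v} → ¬ S u → ¬ S v →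
                     extend c u ≡ extend c v → c u ≡ c v
  extend-same⇒same c {u} {v} u∉S v∉S eq = inject₁-injective (begin
    inject₁ (c u) ≡⟨ sym (extend-outside c u u∉S) ⟩
    extend c u    ≡⟨ eq ⟩
    extend c v    ≡⟨ extend-outside c v v∉S ⟩
    inject₁ (c v) ∎)
    where open ≡-Reasoning

  same⇒extend-same : ∀ {m} (c : Fin n → Fin m) {u v} → ¬ S u → ¬ S v →
                     c u ≡ c v → extend c u ≡ extend c v
  same⇒extend-same c {u} {v} u∉S v∉S eq = begin
    extend c u    ≡⟨ extend-outside c u u∉S ⟩
    inject₁ (c u) ≡⟨ cong inject₁ eq ⟩
    inject₁ (c v) ≡⟨ sym (extend-outside c v v∉S) ⟩
    extend c v    ∎
    where open ≡-Reasoning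

independent-minus : ∀ {n} (G : Graph n) (S : VSet n) (u v : Fin n) →
                    Independent G S → ∀ x y → S x → S y → ¬ AdjMinus G u v x y
independent-minus G S u v S-indep x y x∈S y∈S (xy , _) = S-indep x y x∈S y∈S xy

theorem3p9 : ∀ {n} (k : ℕ) → 2 ≤ k → (G : Graph n) → Chromatic G All k →
    (u v : Fin n) → u ≢ v → (S : VSet n) → CriticalIndependent G k S →
    ¬ S u → ¬ S v →
    (ImplicitEdge G All k u v → ImplicitEdge G (Compl S) (k ∸ 1) u v)
    × (ImplicitIdentity G All k u v → ImplicitIdentity G (Compl S) (k ∸ 1) u v)
theorem3p9 .(suc _) (s≤s _) G _ u v _ S (S-indep , _) u∉S v∉S =
  edge-transfer , identity-transfer
  where
  module Ext = FreshColour (AdjMinus G u v) S (independent-minus G S u v S-indep)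

  edge-transfer : ImplicitEdge G All _ u v → ImplicitEdge G (Compl S) _ u v
  edge-transfer G-edge c c-proper cu≡cv = ¬¬-decidable S λ S? →
    let open Ext S? in
    G-edge (extend c) (extend-proper c c-proper) (same⇒extend-same c u∉S v∉S cu≡cv)

  identity-transfer : ImplicitIdentity G All _ u v → ImplicitIdentity G (Compl S) _ u v
  identity-transfer G-identity c c-proper cu≢cv = ¬¬-decidable S λ S? →
    let open Ext S? in
    G-identity (extend c) (extend-proper c c-proper)
      (λ eq → cu≢cv (extend-same⇒same c u∉S v∉S eq))
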